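{- Let $S$ be a monotone relation from $\mathscr{B}$ to $\mathscr{C}$ and $R$ a monotone relation from $\mathscr{A}$ to $\mathscr{B}$, with associated two-sided discrete fibrations $(d^S_0,\mathscr{E}^S,d^S_1)$ ($d^S_0:\mathscr{E}^S\to\mathscr{C}$, $d^S_1:\mathscr{E}^S\to\mathscr{B}$), $(d^R_0,\mathscr{E}^R,d^R_1)$ ($d^R_0:\mathscr{E}^R\to\mathscr{B}$, $d^R_1:\mathscr{E}^R\to\mathscr{A}$) and $(d^{S\cdot R}_0,\mathscr{E}^{S\cdot R},d^{S\cdot R}_1)$ ($d^{S\cdot R}_0:\mathscr{E}^{S\cdot R}\to\mathscr{C}$, $d^{S\cdot R}_1:\mathscr{E}^{S\cdot R}\to\mathscr{A}$). Let $\mathscr{E}^S\circ\mathscr{E}^R=\{(e,f): d^S_1(e)=d^R_0(f)\}$ be the pullback with projections $q_0,q_1$, and let $w:\mathscr{E}^S\circ\mathscr{E}^R\to\mathscr{E}^{S\cdot R}$ be the map $(e,f)\mapsto(d^S_0e,d^R_1f)$. Then $d^{S\cdot R}_0\circ w=d^S_0\circ q_0$ and $d^{S\cdot R}_1\circ w=d^R_1\circ q_1$; the pullback square $d^S_1 q_0=d^R_0 q_1$ (as a lax square with identity comparison) is exact; and $w$ is a monotone map, surjective on elements, and absolutely dense.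
   Context: Preorders; $\mathscr{X}(x,x')\in\{0,1\}$ is the truth value of $x\le x'$; $\mathbb{2}=\{0\le1\}$. A monotone relation from $\mathscr{X}$ to $\mathscr{Y}$ is a monotone map $R:\mathscr{Y}^{op}\times\mathscr{X}\to\mathbb{2}$; composition: $(S\cdot R)(c,a)=\bigvee_bR(b,a)\wedge S(c,b)$. The associated fibration of $R$ from $\mathscr{X}$ to $\mathscr{Y}$ is $\mathscr{E}^R=\{(y,x):R(y,x)=1\}$ with componentwise order and projections $d_0$ to $\mathscr{Y}$, $d_1$ to $\mathscr{X}$. A lax square $p_0:\mathscr{P}\to\mathscr{X}$, $p_1:\mathscr{P}\to\mathscr{Y}$, $f:\mathscr{X}\to\mathscr{Z}$, $g:\mathscr{Y}\to\mathscr{Z}$ ($fp_0\le gp_1$ pointwise) is exact iff $\mathscr{Z}(fx,gy)=\bigvee_w\mathscr{X}(x,p_0w)\wedge\mathscr{Y}(p_1w,y)$ for all $x,y$. A monotone map $e:\mathscr{X}\to\mathscr{Y}$ is absolutely dense iff $\mathscr{Y}(y,y')=\bigvee_{x}\mathscr{Y}(y,ex)\wedge\mathscr{Y}(ex,y')$ for all $y,y'$. -}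

module Defs where

open import Level using (0ℓ)
open import Data.Product using (Σ; ∃; _×_; _,_; proj₁; proj₂)
open import Function.Bundles using (_⇔_)
open import Relation.Binary.PropositionalEquality using (_≡_; refl; subst; sym)

-- A preorder 𝒳; the truth value 𝒳(x,x') ∈ 𝟚 is rendered as a type x ≤ x'
-- (1 = inhabited, 0 = empty).  Equalities of truth values are logical
-- equivalences (_⇔_), and a join ⋁_w of truth values is ∃ w.
record Pre : Set₁ where
  field
    Carrier : Set
    _≤_     : Carrier → Carrier → Set
    ≤-refl  : ∀ {x} → x ≤ x
    ≤-trans : ∀ {x y z} → x ≤ y → y ≤ z → x ≤ z
open Pre public

record Mono (X Y : Pre) : Set where
  field
    fun  : Carrier X → Carrier Y
    mono : ∀ {x x'} → _≤_ X x x' → _≤_ Y (fun x) (fun x')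
open Mono public

-- a monotone relation from 𝒳 to 𝒴 : a monotone map 𝒴^op × 𝒳 → 𝟚
record MRel (X Y : Pre) : Set₁ where
  field
    rel  : Carrier Y → Carrier X → Set
    mono : ∀ {y y' x x'} → _≤_ Y y' y → _≤_ X x x' → rel y x → rel y' x'
open MRel public

_·_ : {A B C : Pre} → MRel B C → MRel A B → MRel A C
_·_ {A} {B} {C} S R = record
  { rel  = λ c a → ∃ λ b → rel R b a × rel S c b
  ; mono = λ c'≤c a≤a' → λ { (b , r , s) →
      b , MRel.mono R (≤-refl B) a≤a' r , MRel.mono S c'≤c (≤-refl B) s } }

Elt : {X Y : Pre} → MRel X Y → Set
Elt {X} {Y} R = Σ (Carrier Y × Carrier X) λ p → rel R (proj₁ p) (proj₂ p)

ℰ : {X Y : Pre} → MRel X Y → Pre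
ℰ {X} {Y} R = record
  { Carrier = Elt R
  ; _≤_     = λ e e' → _≤_ Y (proj₁ (proj₁ e)) (proj₁ (proj₁ e'))
                     × _≤_ X (proj₂ (proj₁ e)) (proj₂ (proj₁ e'))
  ; ≤-refl  = ≤-refl Y , ≤-refl X
  ; ≤-trans = λ p q → ≤-trans Y (proj₁ p) (proj₁ q) , ≤-trans X (proj₂ p) (proj₂ q) }

d₀ : {X Y : Pre} (R : MRel X Y) → Mono (ℰ R) Y
d₀ R = record { fun = λ e → proj₁ (proj₁ e) ; mono = proj₁ }

d₁ : {X Y : Pre} (R : MRel X Y) → Mono (ℰ R) X
d₁ R = record { fun = λ e → proj₂ (proj₁ e) ; mono = proj₂ }

Pullback : {U V Z : Pre} → Mono U Z → Mono V Z → Pre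
Pullback {U} {V} {Z} f g = record
  { Carrier = Σ (Carrier U × Carrier V) λ p → fun f (proj₁ p) ≡ fun g (proj₂ p)
  ; _≤_     = λ p p' → _≤_ U (proj₁ (proj₁ p)) (proj₁ (proj₁ p'))
                     × _≤_ V (proj₂ (proj₁ p)) (proj₂ (proj₁ p'))
  ; ≤-refl  = ≤-refl U , ≤-refl V
  ; ≤-trans = λ p q → ≤-trans U (proj₁ p) (proj₁ q) , ≤-trans V (proj₂ p) (proj₂ q) }

pq₀ : {U V Z : Pre} (f : Mono U Z) (g : Mono V Z) → Mono (Pullback f g) U
pq₀ f g = record { fun = λ p → proj₁ (proj₁ p) ; mono = proj₁ }

pq₁ : {U V Z : Pre} (f : Mono U Z) (g : Mono V Z) → Mono (Pullback f g) V
pq₁ f g = record { fun = λ p → proj₂ (proj₁ p) ; mono = proj₂ }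

_∘ℰ_ : {A B C : Pre} → MRel B C → MRel A B → Pre
S ∘ℰ R = Pullback (d₁ S) (d₀ R)

q₀ : {A B C : Pre} (S : MRel B C) (R : MRel A B) → Mono (S ∘ℰ R) (ℰ S)
q₀ S R = pq₀ (d₁ S) (d₀ R)

q₁ : {A B C : Pre} (S : MRel B C) (R : MRel A B) → Mono (S ∘ℰ R) (ℰ R)
q₁ S R = pq₁ (d₁ S) (d₀ R)

-- w : ℰ^S ∘ ℰ^R → ℰ^{S·R},  (e,f) ↦ (d₀ˢ e, d₁ᴿ f)   (the underlying function;
-- its monotonicity is part of the statement)
w : {A B C : Pre} (S : MRel B C) (R : MRel A B) → Carrier (S ∘ℰ R) → Elt (S · R)
w S R (((((c , b) , s) , ((b' , a) , r))) , eq) =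
  (c , a) , b , subst (λ z → rel R z a) (sym eq) r , s

IsMonotone : (X Y : Pre) → (Carrier X → Carrier Y) → Set
IsMonotone X Y h = ∀ {x x'} → _≤_ X x x' → _≤_ Y (h x) (h x')

LaxSquare : {P X Y Z : Pre} → Mono P X → Mono P Y → Mono X Z → Mono Y Z → Set
LaxSquare {P} {X} {Y} {Z} p₀ p₁ f g =
  ∀ (u : Carrier P) → _≤_ Z (fun f (fun p₀ u)) (fun g (fun p₁ u))

IsExact : {P X Y Z : Pre} → Mono P X → Mono P Y → Mono X Z → Mono Y Z → Set
IsExact {P} {X} {Y} {Z} p₀ p₁ f g =
  ∀ (x : Carrier X) (y : Carrier Y) →
    _≤_ Z (fun f x) (fun g y) ⇔ (∃ λ u → _≤_ X x (fun p₀ u) × _≤_ Y (fun p₁ u) y)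

IsSurjective : (X Y : Pre) → (Carrier X → Carrier Y) → Set
IsSurjective X Y h = ∀ (y : Carrier Y) → ∃ λ x → h x ≡ y

IsAbsolutelyDense : (X Y : Pre) → (Carrier X → Carrier Y) → Set
IsAbsolutelyDense X Y e =
  ∀ (y y' : Carrier Y) → _≤_ Y y y' ⇔ (∃ λ x → _≤_ Y y (e x) × _≤_ Y (e x) y')

module Submission where

--   * every pullback square of monotone maps commutes, hence is a lax square
--     with identity comparison;
--   * a pullback square is exact as soon as one of the two maps being pulled
--     back lifts inequalities upwards (every f u ≤ z is f of some u' ≥ u);
--   * every surjective map into a preorder is absolutely dense.
--
-- The projection d₁ˢ : ℰˢ → ℬ of a two-sided discrete fibration lifts
-- inequalities upwards because S(c, -) is monotone, which gives exactness.
-- For w itself we check monotonicity and surjectivity directly (a witness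
-- (c, a) ∈ ℰ^{S·R} carries a middle element b with R(b,a) and S(c,b));
-- absolute density then follows from surjectivity.

open import Defs
open import Data.Product using (∃; _×_; _,_; proj₂)
open import Relation.Binary.PropositionalEquality using (_≡_; refl)
open import Function.Bundles using (mk⇔)

≤-respʳ-≡ : (X : Pre) {x y z : Carrier X} → _≤_ X x y → y ≡ z → _≤_ X x z
≤-respʳ-≡ X x≤y refl = x≤y

pullback-commutes : {U V Z : Pre} (f : Mono U Z) (g : Mono V Z) →
  (p : Carrier (Pullback f g)) → fun f (fun (pq₀ f g) p) ≡ fun g (fun (pq₁ f g) p)
pullback-commutes f g p = proj₂ p

pullback-lax : {U V Z : Pre} (f : Mono U Z) (g : Mono V Z) →
  LaxSquare (pq₀ f g) (pq₁ f g) f g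
pullback-lax {Z = Z} f g p = ≤-respʳ-≡ Z (≤-refl Z) (pullback-commutes f g p)

LiftsUpward : {U Z : Pre} → Mono U Z → Set
LiftsUpward {U} {Z} f =
  ∀ (u : Carrier U) (z : Carrier Z) → _≤_ Z (fun f u) z →
    ∃ λ u' → _≤_ U u u' × fun f u' ≡ z

-- The pullback of a map that lifts inequalities upwards is an exact square.
-- (⇐) holds for every pullback: f x ≤ f u = g v ≤ g y.
-- (⇒) lift x along f x ≤ g y to u' over g y; then (u', y) is the witness.
pullback-exact : {U V Z : Pre} (f : Mono U Z) (g : Mono V Z) →
  LiftsUpward f → IsExact (pq₀ f g) (pq₁ f g) f g
pullback-exact {U} {V} {Z} f g lift x y = mk⇔ factor join
  where
  factor : _≤_ Z (fun f x) (fun g y) →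
    ∃ λ p → _≤_ U x (fun (pq₀ f g) p) × _≤_ V (fun (pq₁ f g) p) y
  factor fx≤gy with lift x (fun g y) fx≤gy
  ... | u' , x≤u' , fu'≡gy = ((u' , y) , fu'≡gy) , x≤u' , ≤-refl V

  join : (∃ λ p → _≤_ U x (fun (pq₀ f g) p) × _≤_ V (fun (pq₁ f g) p) y) →
    _≤_ Z (fun f x) (fun g y)
  join (((u , v) , fu≡gv) , x≤u , v≤y) =
    ≤-trans Z (≤-respʳ-≡ Z (mono f x≤u) fu≡gv) (mono g v≤y)

surjective⇒absolutelyDense : (X Y : Pre) (e : Carrier X → Carrier Y) →
  IsSurjective X Y e → IsAbsolutelyDense X Y e
surjective⇒absolutelyDense X Y e surj y y' = mk⇔ factor join
  where
  factor : _≤_ Y y y' → ∃ λ x → _≤_ Y y (e x) × _≤_ Y (e x) y'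
  factor y≤y' with surj y
  ... | x , refl = x , ≤-refl Y , y≤y'

  join : (∃ λ x → _≤_ Y y (e x) × _≤_ Y (e x) y') → _≤_ Y y y'
  join (x , y≤ex , ex≤y') = ≤-trans Y y≤ex ex≤y'

-- The projection d₁ : ℰ^S → ℬ lifts inequalities upwards:
-- S(c,b) and b ≤ b' give S(c,b'), i.e. (c,b) ≤ (c,b') in ℰ^S.
d₁-liftsUpward : {B C : Pre} (S : MRel B C) → LiftsUpward (d₁ S)
d₁-liftsUpward {B} {C} S ((c , b) , s) b' b≤b' =
  ((c , b') , MRel.mono S (≤-refl C) b≤b' s) , (≤-refl C , b≤b') , refl

w-monotone : {A B C : Pre} (S : MRel B C) (R : MRel A B) →
  IsMonotone (S ∘ℰ R) (ℰ (S · R)) (w S R)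
w-monotone S R ((c≤c' , _) , (_ , a≤a')) = c≤c' , a≤a'

-- w is surjective: a witness b of (S·R)(c,a) gives the preimage
-- ((c,b), (b,a)) in the pullback.
w-surjective : {A B C : Pre} (S : MRel B C) (R : MRel A B) →
  IsSurjective (S ∘ℰ R) (ℰ (S · R)) (w S R)
w-surjective S R ((c , a) , b , r , s) = ((((c , b) , s) , ((b , a) , r)) , refl) , refl

w-over-d₀ : {A B C : Pre} (S : MRel B C) (R : MRel A B) →
  (x : Carrier (S ∘ℰ R)) → fun (d₀ (S · R)) (w S R x) ≡ fun (d₀ S) (fun (q₀ S R) x)
w-over-d₀ S R ((((c , b) , s) , ((b' , a) , r)) , eq) = refl

w-over-d₁ : {A B C : Pre} (S : MRel B C) (R : MRel A B) →
  (x : Carrier (S ∘ℰ R)) → fun (d₁ (S · R)) (w S R x) ≡ fun (d₁ R) (fun (q₁ S R) x)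
w-over-d₁ S R ((((c , b) , s) , ((b' , a) , r)) , eq) = refl

corollary3p7 : (A B C : Pre) (S : MRel B C) (R : MRel A B) →
    ((x : Carrier (S ∘ℰ R)) → fun (d₀ (S · R)) (w S R x) ≡ fun (d₀ S) (fun (q₀ S R) x))
    × ((x : Carrier (S ∘ℰ R)) → fun (d₁ (S · R)) (w S R x) ≡ fun (d₁ R) (fun (q₁ S R) x))
    × ((x : Carrier (S ∘ℰ R)) → fun (d₁ S) (fun (q₀ S R) x) ≡ fun (d₀ R) (fun (q₁ S R) x))
    × LaxSquare (q₀ S R) (q₁ S R) (d₁ S) (d₀ R)
    × IsExact (q₀ S R) (q₁ S R) (d₁ S) (d₀ R)
    × IsMonotone (S ∘ℰ R) (ℰ (S · R)) (w S R)
    × IsSurjective (S ∘ℰ R) (ℰ (S · R)) (w S R)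
    × IsAbsolutelyDense (S ∘ℰ R) (ℰ (S · R)) (w S R)
corollary3p7 A B C S R =
    w-over-d₀ S R
  , w-over-d₁ S R
  , pullback-commutes (d₁ S) (d₀ R)
  , pullback-lax (d₁ S) (d₀ R)
  , pullback-exact (d₁ S) (d₀ R) (d₁-liftsUpward S)
  , (λ {x} {x'} → w-monotone S R {x} {x'})
  , w-surjective S R
  , surjective⇒absolutelyDense (S ∘ℰ R) (ℰ (S · R)) (w S R) (w-surjective S R)
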